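{- Let $N\ge1$ be an odd integer with $N=N_0N_1$, $N_0,N_1$ positive and $\gcd(N_0,N_1)=1$. Let $p$ be an odd prime with $p\nmid N$ and let $\Delta$ be a discriminant with $p^2\mid\Delta$. Then the map $\mathrm{id}:[aNp,b,c]\mapsto[(ap)N,b,c]$ induces a bijection \[ \mathcal L^{[p],a}_{Np}(N_0^2\Delta)/\Gamma_0(Np)\ \longrightarrow\ \mathcal L^{[p]}_N(N_0^2\Delta)/\Gamma_0(N), \] and the map $\tau:[aNp,b,c]\mapsto[aN,b,cp]$ induces a bijection \[ \mathcal L^{[p],c}_{Np}(N_0^2\Delta)/\Gamma_0(Np)\ \longrightarrow\ \mathcal L^{[p]}_N(N_0^2\Delta)/\Gamma_0(N). \]
   Context: $[a,b,c]$ denotes the integral binary quadratic form $aX^2+bXY+cY^2$, with discriminant $b^2-4ac$; $\gamma\in\Gamma_0(M)$ acts by $(Q\circ\gamma)(X,Y)=Q((X,Y){}^t\gamma)$. For $M\ge1$ and an integer $D$, $\mathcal L_M(D)$ is the set of forms $[a,b,c]$ with $b^2-4ac=D$, $M\mid a$ and $\gcd(N_0,c)=1$. For $M\in\{N,Np\}$, writing forms of $\mathcal L_M(D)$ as $[aM,b,c]$, let $\mathcal L^{[p]}_M(D)$ be the subset of those with $p\nmid\gcd(a,b,c)$ (the forms $d\cdot Q'$ with $Q'=[a'M,b',c']$, $\gcd(a',b',c')=1$, and $p\nmid d$). Every $[aNp,b,c]\in\mathcal L^{[p]}_{Np}(N_0^2\Delta)$ satisfies exactly one of: ($p\mid a$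 and $p\nmid c$), or ($p\nmid a$ and $p\mid c$); $\mathcal L^{[p],a}_{Np}(N_0^2\Delta)$ and $\mathcal L^{[p],c}_{Np}(N_0^2\Delta)$ denote the subsets of forms of the first and second kind respectively (both $\Gamma_0(Np)$-stable). A discriminant is an integer congruent to $0$ or $1$ modulo $4$. -}

module Defs where

open import Data.Nat as ℕ using (ℕ)
open import Data.Nat.Coprimality using (Coprime)
open import Data.Integer as ℤ using (ℤ; +_; _+_; _-_; _*_)
open import Data.Integer.Divisibility using (_∣_)
open import Data.Integer.DivMod using (_/_)
open import Data.Product using (Σ; ∃; _×_; _,_)
open import Relation.Nullary using (¬_)
open import Relation.Binary.PropositionalEquality using (_≡_)

-- A binary quadratic form [a,b,c] = aX² + bXY + cY².
Form : Set
Form = ℤ × ℤ × ℤ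

disc : Form → ℤ
disc (a , b , c) = b * b - + 4 * a * c

record Γ₀ (M : ℕ) : Set where
  constructor mat
  field
    α β γ δ : ℤ
    det≡1   : α * δ - β * γ ≡ + 1
    M∣γ     : + M ∣ γ

-- (Q ∘ g)(X,Y) = Q((X,Y) ᵗg) = Q(αX + βY, γX + δY).
act : ∀ {M} → Form → Γ₀ M → Form
act (a , b , c) (mat α β γ δ _ _) =
  ( a * α * α + b * α * γ + c * γ * γ
  , + 2 * a * α * β + b * (α * δ + β * γ) + + 2 * c * γ * δ
  , a * β * β + b * β * δ + c * δ * δ )

Equiv : ℕ → Form → Form → Set
Equiv M Q Q' = Σ (Γ₀ M) λ g → act Q g ≡ Q'

InL : (N₀ M : ℕ) (D : ℤ) → Form → Set
InL N₀ M D (a , b , c) = disc (a , b , c) ≡ D × + M ∣ a × Coprime N₀ (ℤ.∣ c ∣)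

InLp : (p N₀ M : ℕ) (D : ℤ) → Form → Set
InLp p N₀ M D (A , b , c) =
  InL N₀ M D (A , b , c) ×
  ∃ λ a → A ≡ a * + M × ¬ (+ p ∣ a × + p ∣ b × + p ∣ c)

InLpa : (p N₀ M : ℕ) (D : ℤ) → Form → Set
InLpa p N₀ M D (A , b , c) =
  InLp p N₀ M D (A , b , c) ×
  ∃ λ a → A ≡ a * + M × + p ∣ a × ¬ (+ p ∣ c)

InLpc : (p N₀ M : ℕ) (D : ℤ) → Form → Set
InLpc p N₀ M D (A , b , c) =
  InLp p N₀ M D (A , b , c) ×
  ∃ λ a → A ≡ a * + M × ¬ (+ p ∣ a) × + p ∣ c

-- The map id : [aNp,b,c] ↦ [(ap)N,b,c] (the same triple of coefficients).
idMap : Form → Form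
idMap Q = Q

tau : (p : ℕ) → .{{ℕ.NonZero p}} → Form → Form
tau p (A , b , c) = (A / + p , b , c * + p)

-- f : S → T induces a bijection S/≈_M → T/≈_M' (S,T stable subsets):
-- f maps S into T, respects and reflects equivalence, and is surjective
-- onto classes of T.
InducesBijection : (S : Form → Set) (M : ℕ) (T : Form → Set) (M' : ℕ)
                   (f : Form → Form) → Set
InducesBijection S M T M' f =
  (∀ Q → S Q → T (f Q)) ×
  (∀ Q Q' → S Q → S Q' → Equiv M Q Q' → Equiv M' (f Q) (f Q')) ×
  (∀ Q Q' → S Q → S Q' → Equiv M' (f Q) (f Q') → Equiv M Q Q') ×
  (∀ R → T R → ∃ λ Q → S Q × Equiv M' (f Q) R)

{-# OPTIONS --safe #-}
module Submission where

-- τ is conjugation by diag(1, p): if h ∈ Γ₀(Np) and g ∈ Γ₀(N) correspond under it, then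
-- Q ∘ h = Q′ iff τQ ∘ g = τQ′; for id, simply Γ₀(Np) ⊆ Γ₀(N). Since p² ∣ D forces p ∣ b whenever
-- p divides a or c, a Γ₀(N)-equivalence between two forms with p ∣ a, p ∤ c has p ∣ γ, so lies in
-- Γ₀(Np), and one between τ-images of forms with p ∤ a, p ∣ c has p ∣ β, so comes from Γ₀(Np) by
-- conjugation. For surjectivity, a unipotent shift by N first makes c (resp. a) prime to p; a second
-- shift [1,0;Nt,1] (resp. [1,Nt;0,1]), with 2cNt + b ≡ 0 (resp. 2aNt + b ≡ 0) mod p, completes the
-- square: 4ca′ = (2cNt + b)² − D, so p² divides the new a (resp. c), as the source set requires.

open import Defs
open import Data.Nat as ℕ using (ℕ; suc)
import Data.Nat.Properties as ℕ
import Data.Nat.Divisibility as ℕ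
open import Data.Nat.Coprimality as Coprimality using (Coprime)
open import Data.Nat.GCD using (module Bézout)
open import Data.Nat.Primality using (Prime; euclidsLemma; prime⇒irreducible; prime[2]; ¬prime[1])
open import Data.Integer as ℤ using (ℤ; +_; -_; _+_; _-_; _*_)
import Data.Integer.Properties as ℤ
open import Data.Integer.DivMod using (_/_; _%_; n%d<d; a≡a%n+[a/n]*n)
import Data.Integer.Coprimality as ℤ
open import Data.Integer.Divisibility using () renaming (_∣_ to _∣ᵤ_)
open import Data.Integer.Divisibility.Signed
open import Data.Integer.Tactic.RingSolver using (solve-∀)
open import Data.Product using (∃; _×_; _,_; proj₁; proj₂)
open import Data.Sum using (_⊎_; inj₁; inj₂)
open import Function.Base using (_∘_)
open import Function.Bundles using (_⇔_; mk⇔; module Equivalence)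
open import Relation.Nullary using (¬_; yes; no; contradiction)
open import Relation.Binary.PropositionalEquality
open ≡-Reasoning

form-≡ : ∀ {a b c a′ b′ c′ : ℤ} → a ≡ a′ → b ≡ b′ → c ≡ c′ → _≡_ {A = Form} (a , b , c) (a′ , b′ , c′)
form-≡ refl refl refl = refl

coeffA coeffC : Form → ℤ
coeffA (a , _ , _) = a
coeffC (_ , _ , c) = c

-- The ring solver does not unfold act, so the coefficient identities below are spelled out.

module _ {M : ℕ} where

  Γ₀-identity : Γ₀ M
  Γ₀-identity = mat (+ 1) (+ 0) (+ 0) (+ 1) refl (M ℕ.∣0)

  _∙_ : Γ₀ M → Γ₀ M → Γ₀ M
  mat α β γ δ e d ∙ mat α′ β′ γ′ δ′ e′ d′ =
    mat (α * α′ + β * γ′) (α * β′ + β * δ′) (γ * α′ + δ * γ′) (γ * β′ + δ * δ′)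
        (trans (det-mul α β γ δ α′ β′ γ′ δ′) (cong₂ _*_ e e′))
        (∣⇒∣ᵤ (∣m∣n⇒∣m+n (∣m⇒∣m*n α′ (∣ᵤ⇒∣ {+ M} {γ} d)) (∣n⇒∣m*n δ (∣ᵤ⇒∣ {+ M} {γ′} d′))))
    where
    det-mul : ∀ α β γ δ α′ β′ γ′ δ′ →
      (α * α′ + β * γ′) * (γ * β′ + δ * δ′) - (α * β′ + β * δ′) * (γ * α′ + δ * γ′)
        ≡ (α * δ - β * γ) * (α′ * δ′ - β′ * γ′)
    det-mul = solve-∀

  _⁻¹ : Γ₀ M → Γ₀ M
  mat α β γ δ e d ⁻¹ = mat δ (- β) (- γ) α (trans (det-inv α β γ δ) e) (∣⇒∣ᵤ (∣m⇒∣-m (∣ᵤ⇒∣ {+ M} {γ} d)))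
    where
    det-inv : ∀ α β γ δ → δ * α - (- β) * (- γ) ≡ α * δ - β * γ
    det-inv = solve-∀

  act-identity : ∀ Q → act Q Γ₀-identity ≡ Q
  act-identity (a , b , c) = form-≡ (first a b c) (middle a b c) (last a b c)
    where
    first : ∀ a b c → a * + 1 * + 1 + b * + 1 * + 0 + c * + 0 * + 0 ≡ a
    first = solve-∀
    middle : ∀ a b c → + 2 * a * + 1 * + 0 + b * (+ 1 * + 1 + + 0 * + 0) + + 2 * c * + 0 * + 1 ≡ b
    middle = solve-∀
    last : ∀ a b c → a * + 0 * + 0 + b * + 0 * + 1 + c * + 1 * + 1 ≡ c
    last = solve-∀

  act-∙ : ∀ Q (g h : Γ₀ M) → act (act Q g) h ≡ act Q (g ∙ h)
  act-∙ (a , b , c) (mat α β γ δ _ _) (mat α′ β′ γ′ δ′ _ _) =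
    form-≡ (first a b c α β γ δ α′ β′ γ′ δ′) (middle a b c α β γ δ α′ β′ γ′ δ′)
           (last a b c α β γ δ α′ β′ γ′ δ′)
    where
    first : ∀ a b c α β γ δ α′ β′ γ′ δ′ →
      (a * α * α + b * α * γ + c * γ * γ) * α′ * α′
        + (+ 2 * a * α * β + b * (α * δ + β * γ) + + 2 * c * γ * δ) * α′ * γ′
        + (a * β * β + b * β * δ + c * δ * δ) * γ′ * γ′
      ≡ a * (α * α′ + β * γ′) * (α * α′ + β * γ′) + b * (α * α′ + β * γ′) * (γ * α′ + δ * γ′)
        + c * (γ * α′ + δ * γ′) * (γ * α′ + δ * γ′)
    first = solve-∀
    middle : ∀ a b c α β γ δ α′ β′ γ′ δ′ →
      + 2 * (a * α * α + b * α * γ + c * γ * γ) * α′ * β′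
        + (+ 2 * a * α * β + b * (α * δ + β * γ) + + 2 * c * γ * δ) * (α′ * δ′ + β′ * γ′)
        + + 2 * (a * β * β + b * β * δ + c * δ * δ) * γ′ * δ′
      ≡ + 2 * a * (α * α′ + β * γ′) * (α * β′ + β * δ′)
        + b * ((α * α′ + β * γ′) * (γ * β′ + δ * δ′) + (α * β′ + β * δ′) * (γ * α′ + δ * γ′))
        + + 2 * c * (γ * α′ + δ * γ′) * (γ * β′ + δ * δ′)
    middle = solve-∀
    last : ∀ a b c α β γ δ α′ β′ γ′ δ′ →
      (a * α * α + b * α * γ + c * γ * γ) * β′ * β′
        + (+ 2 * a * α * β + b * (α * δ + β * γ) + + 2 * c * γ * δ) * β′ * δ′
        + (a * β * β + b * β * δ + c * δ * δ) * δ′ * δ′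
      ≡ a * (α * β′ + β * δ′) * (α * β′ + β * δ′) + b * (α * β′ + β * δ′) * (γ * β′ + δ * δ′)
        + c * (γ * β′ + δ * δ′) * (γ * β′ + δ * δ′)
    last = solve-∀

  act-⁻¹ : ∀ Q (g : Γ₀ M) → act (act Q g) (g ⁻¹) ≡ Q
  act-⁻¹ (a , b , c) (mat α β γ δ e _) = form-≡
    (times-det² a (first a b c α β γ δ))
    (times-det² b (middle a b c α β γ δ))
    (times-det² c (last a b c α β γ δ))
    where
    times-det² : ∀ {x} y → x ≡ y * ((α * δ - β * γ) * (α * δ - β * γ)) → x ≡ y
    times-det² y eq = trans eq (trans (cong (λ d → y * (d * d)) e) (ℤ.*-identityʳ y))
    first : ∀ a b c α β γ δ →
      (a * α * α + b * α * γ + c * γ * γ) * δ * δ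
        + (+ 2 * a * α * β + b * (α * δ + β * γ) + + 2 * c * γ * δ) * δ * (- γ)
        + (a * β * β + b * β * δ + c * δ * δ) * (- γ) * (- γ)
      ≡ a * ((α * δ - β * γ) * (α * δ - β * γ))
    first = solve-∀
    middle : ∀ a b c α β γ δ →
      + 2 * (a * α * α + b * α * γ + c * γ * γ) * δ * (- β)
        + (+ 2 * a * α * β + b * (α * δ + β * γ) + + 2 * c * γ * δ) * (δ * α + (- β) * (- γ))
        + + 2 * (a * β * β + b * β * δ + c * δ * δ) * (- γ) * α
      ≡ b * ((α * δ - β * γ) * (α * δ - β * γ))
    middle = solve-∀
    last : ∀ a b c α β γ δ →
      (a * α * α + b * α * γ + c * γ * γ) * (- β) * (- β)
        + (+ 2 * a * α * β + b * (α * δ + β * γ) + + 2 * c * γ * δ) * (- β) * α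
        + (a * β * β + b * β * δ + c * δ * δ) * α * α
      ≡ c * ((α * δ - β * γ) * (α * δ - β * γ))
    last = solve-∀

  disc-act : ∀ Q (g : Γ₀ M) → disc (act Q g) ≡ disc Q
  disc-act (a , b , c) g@(mat α β γ δ e _) = begin
    disc (act (a , b , c) g)                     ≡⟨ disc-transform a b c α β γ δ ⟩
    disc (a , b , c) * ((α * δ - β * γ) * (α * δ - β * γ)) ≡⟨ cong (λ d → disc (a , b , c) * (d * d)) e ⟩
    disc (a , b , c) * + 1                       ≡⟨ ℤ.*-identityʳ _ ⟩
    disc (a , b , c)                             ∎
    where
    disc-transform : ∀ a b c α β γ δ →
      (+ 2 * a * α * β + b * (α * δ + β * γ) + + 2 * c * γ * δ)
        * (+ 2 * a * α * β + b * (α * δ + β * γ) + + 2 * c * γ * δ)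
        - + 4 * (a * α * α + b * α * γ + c * γ * γ) * (a * β * β + b * β * δ + c * δ * δ)
      ≡ (b * b - + 4 * a * c) * ((α * δ - β * γ) * (α * δ - β * γ))
    disc-transform = solve-∀

  Equiv-refl : ∀ {Q} → Equiv M Q Q
  Equiv-refl {Q} = Γ₀-identity , act-identity Q

  Equiv-sym : ∀ {Q R} → Equiv M Q R → Equiv M R Q
  Equiv-sym {Q} (g , refl) = g ⁻¹ , act-⁻¹ Q g

  Equiv-trans : ∀ {Q R S} → Equiv M Q R → Equiv M R S → Equiv M Q S
  Equiv-trans {Q} (g , refl) (h , refl) = g ∙ h , sym (act-∙ Q g h)

  upper : ℤ → Γ₀ M
  upper t = mat (+ 1) t (+ 0) (+ 1) (det-upper t) (M ℕ.∣0)
    where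
    det-upper : ∀ t → + 1 * + 1 - t * + 0 ≡ + 1
    det-upper = solve-∀

  lower : (s : ℤ) → + M ∣ s → Γ₀ M
  lower s M∣s = mat (+ 1) (+ 0) s (+ 1) (det-lower s) (∣⇒∣ᵤ M∣s)
    where
    det-lower : ∀ s → + 1 * + 1 - + 0 * s ≡ + 1
    det-lower = solve-∀

  act-upper : ∀ a b c t → act (a , b , c) (upper t) ≡ (a , b + + 2 * a * t , a * t * t + b * t + c)
  act-upper a b c t = form-≡ (first a b c t) (middle a b c t) (last a b c t)
    where
    first : ∀ a b c t → a * + 1 * + 1 + b * + 1 * + 0 + c * + 0 * + 0 ≡ a
    first = solve-∀
    middle : ∀ a b c t → + 2 * a * + 1 * t + b * (+ 1 * + 1 + t * + 0) + + 2 * c * + 0 * + 1 ≡ b + + 2 * a * t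
    middle = solve-∀
    last : ∀ a b c t → a * t * t + b * t * + 1 + c * + 1 * + 1 ≡ a * t * t + b * t + c
    last = solve-∀

  act-lower : ∀ a b c s M∣s →
    act (a , b , c) (lower s M∣s) ≡ (a + b * s + c * s * s , b + + 2 * c * s , c)
  act-lower a b c s _ = form-≡ (first a b c s) (middle a b c s) (last a b c s)
    where
    first : ∀ a b c s → a * + 1 * + 1 + b * + 1 * s + c * s * s ≡ a + b * s + c * s * s
    first = solve-∀
    middle : ∀ a b c s → + 2 * a * + 1 * + 0 + b * (+ 1 * + 1 + + 0 * s) + + 2 * c * s * + 1 ≡ b + + 2 * c * s
    middle = solve-∀
    last : ∀ a b c s → a * + 0 * + 0 + b * + 0 * + 1 + c * + 1 * + 1 ≡ c
    last = solve-∀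

Equiv-∣ : ∀ {M M′ Q R} → M ℕ.∣ M′ → Equiv M′ Q R → Equiv M Q R
Equiv-∣ M∣M′ (mat α β γ δ e M′∣γ , eq) = mat α β γ δ e (ℕ.∣-trans M∣M′ M′∣γ) , eq

coprime-square : ∀ {m n} → Coprime m n → Coprime (m ℕ.* m) n
coprime-square c (i∣m*m , i∣n) =
  c (Coprimality.coprime-divisor (λ (j∣i , j∣m) → c (j∣m , ℕ.∣-trans j∣i i∣n)) i∣m*m , i∣n)

coprime⇒*∣ : ∀ {m n o} → Coprime m n → m ℕ.∣ o → n ℕ.∣ o → m ℕ.* n ℕ.∣ o
coprime⇒*∣ {m} {n} c (ℕ.divides q refl) n∣q*m
  with Coprimality.coprime-divisor (Coprimality.sym c) (subst (n ℕ.∣_) (ℕ.*-comm q m) n∣q*m)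
... | ℕ.divides r refl = ℕ.divides r (trans (ℕ.*-assoc r n m) (cong (r ℕ.*_) (ℕ.*-comm n m)))

coprime-* : ∀ {n a b} → Coprime n a → Coprime n b → Coprime n (a ℕ.* b)
coprime-* n⊥a n⊥b (i∣n , i∣ab) =
  n⊥b (i∣n , Coprimality.coprime-divisor (λ (j∣i , j∣a) → n⊥a (ℕ.∣-trans j∣i i∣n , j∣a)) i∣ab)

coprime-∣ : ∀ {n a b} → Coprime n a → b ℕ.∣ a → Coprime n b
coprime-∣ n⊥a b∣a (i∣n , i∣b) = n⊥a (i∣n , ℕ.∣-trans i∣b b∣a)

coprime-+∣ : ∀ {n x c} → + n ∣ x → Coprime n ℤ.∣ c ∣ → Coprime n ℤ.∣ x + c ∣
coprime-+∣ {n} {x} {c} n∣x n⊥c {i} (i∣n , i∣x+c) =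
  n⊥c (i∣n , ∣⇒∣ᵤ (∣m+n∣m⇒∣n (∣ᵤ⇒∣ {+ i} {x + c} i∣x+c) (∣-trans (∣ᵤ⇒∣ {+ i} {+ n} i∣n) n∣x)))

*-pos-* : ∀ a m n → a * + (m ℕ.* n) ≡ a * + m * + n
*-pos-* a m n = trans (cong (a *_) (ℤ.pos-* m n)) (sym (ℤ.*-assoc a (+ m) (+ n)))

∤⇒∤ᵤ : ∀ {k} x → ¬ k ∣ x → ¬ k ∣ᵤ x
∤⇒∤ᵤ {k} x k∤x k∣x = k∤x (∣ᵤ⇒∣ {k} {x} k∣x)

i*n/n≡i : ∀ i n .{{_ : ℕ.NonZero n}} → i * + n / + n ≡ i
i*n/n≡i i n = ℤ.*-cancelʳ-≡ q i (+ n) (sym (begin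
  i * + n          ≡⟨ division ⟩
  + r + q * + n    ≡⟨ cong (λ r → + r + q * + n) r≡0 ⟩
  + 0 + q * + n    ≡⟨ ℤ.+-identityˡ (q * + n) ⟩
  q * + n          ∎))
  where
  q = i * + n / + n
  r = i * + n % + n
  division : i * + n ≡ + r + q * + n
  division = a≡a%n+[a/n]*n (i * + n) (+ n)
  n∣r : + n ∣ + r
  n∣r = ∣m+n∣n⇒∣m (subst (+ n ∣_) division (divides i refl)) (divides q refl)
  r≡0 : r ≡ 0
  r≡0 with r | n%d<d (i * + n) (+ n) | n∣r
  ... | 0     | _   | _   = refl
  ... | suc _ | r<n | n∣r = contradiction (∣⇒∣ᵤ n∣r) (ℕ.>⇒∤ r<n)

∣⇒∣² : ∀ {k x} → k ∣ x → k * k ∣ x * x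
∣⇒∣² {k} {x} k∣x = ∣-trans (*-monoʳ-∣ k k∣x) (*-monoˡ-∣ x k∣x)

1+*≡*⇒ℤ : ∀ a b c d → 1 ℕ.+ a ℕ.* b ≡ c ℕ.* d → + 1 + + a * + b ≡ + c * + d
1+*≡*⇒ℤ a b c d eq = begin
  + 1 + + a * + b       ≡⟨ cong (λ z → + 1 + z) (ℤ.pos-* a b) ⟨
  + 1 + + (a ℕ.* b)     ≡⟨ ℤ.pos-+ 1 (a ℕ.* b) ⟨
  + (1 ℕ.+ a ℕ.* b)     ≡⟨ cong +_ eq ⟩
  + (c ℕ.* d)           ≡⟨ ℤ.pos-* c d ⟩
  + c * + d             ∎

module _ {p : ℕ} (p-prime : Prime p) where

  ∣*⇒∣⊎∣ : ∀ x y → + p ∣ x * y → + p ∣ x ⊎ + p ∣ y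
  ∣*⇒∣⊎∣ x y p∣xy with euclidsLemma ℤ.∣ x ∣ ℤ.∣ y ∣ p-prime (subst (p ℕ.∣_) (ℤ.abs-* x y) (∣⇒∣ᵤ p∣xy))
  ... | inj₁ p∣x = inj₁ (∣ᵤ⇒∣ p∣x)
  ... | inj₂ p∣y = inj₂ (∣ᵤ⇒∣ p∣y)

  ∤*∤⇒∤* : ∀ {x y} → ¬ + p ∣ x → ¬ + p ∣ y → ¬ + p ∣ x * y
  ∤*∤⇒∤* {x} {y} p∤x p∤y p∣xy with ∣*⇒∣⊎∣ x y p∣xy
  ... | inj₁ p∣x = p∤x p∣x
  ... | inj₂ p∣y = p∤y p∣y

  ∣x*x⇒∣x : ∀ x → + p ∣ x * x → + p ∣ x
  ∣x*x⇒∣x x p∣xx with ∣*⇒∣⊎∣ x x p∣xx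
  ... | inj₁ p∣x = p∣x
  ... | inj₂ p∣x = p∣x

  ∣k*x*x⇒∣x : ∀ {k} x → ¬ + p ∣ k → + p ∣ k * x * x → + p ∣ x
  ∣k*x*x⇒∣x {k} x p∤k p∣kxx with ∣*⇒∣⊎∣ (k * x) x p∣kxx
  ... | inj₂ p∣x = p∣x
  ... | inj₁ p∣kx with ∣*⇒∣⊎∣ k x p∣kx
  ...   | inj₁ p∣k = contradiction p∣k p∤k
  ...   | inj₂ p∣x = p∣x

  ∤⇒coprime : ∀ {n} → ¬ p ℕ.∣ n → Coprime p n
  ∤⇒coprime p∤n (i∣p , i∣n) with prime⇒irreducible p-prime i∣p
  ... | inj₁ i≡1 = i≡1
  ... | inj₂ refl = contradiction i∣n p∤n

  ∤-quadratic : ∀ {u v w n} → ¬ + p ∣ u → ¬ + p ∣ n → + p ∣ v → + p ∣ w → ¬ + p ∣ u * n * n + v * n + w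
  ∤-quadratic {n = n} p∤u p∤n p∣v p∣w p∣value =
    ∤*∤⇒∤* (∤*∤⇒∤* p∤u p∤n) p∤n (∣m+n∣n⇒∣m (∣m+n∣n⇒∣m p∣value p∣w) (∣m⇒∣m*n n p∣v))

  linear-congruenceᴺ : ∀ {m} → ¬ p ℕ.∣ m → ∀ b → ∃ λ t → + p ∣ + m * t + b
  linear-congruenceᴺ {m} p∤m b with Coprimality.coprime-Bézout (∤⇒coprime p∤m)
  ... | Bézout.+- x y eq = + y * b , divides (+ x * b) (begin
    + m * (+ y * b) + b        ≡⟨ factor (+ m) (+ y) b ⟩
    (+ 1 + + y * + m) * b      ≡⟨ cong (_* b) (1+*≡*⇒ℤ y m x p eq) ⟩
    + x * + p * b              ≡⟨ swap (+ x) (+ p) b ⟩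
    + x * b * + p              ∎)
    where
    factor : ∀ m y b → m * (y * b) + b ≡ (+ 1 + y * m) * b
    factor = solve-∀
    swap : ∀ x p b → x * p * b ≡ x * b * p
    swap = solve-∀
  ... | Bézout.-+ x y eq = - (+ y * b) , divides (- (+ x * b)) (begin
    + m * - (+ y * b) + b          ≡⟨ factor (+ m) (+ y) b ⟩
    (+ 1 - + y * + m) * b          ≡⟨ cong (λ z → (+ 1 - z) * b) (1+*≡*⇒ℤ x p y m eq) ⟨
    (+ 1 - (+ 1 + + x * + p)) * b  ≡⟨ cancel (+ x) (+ p) b ⟩
    - (+ x * b) * + p              ∎)
    where
    factor : ∀ m y b → m * - (y * b) + b ≡ (+ 1 - y * m) * b
    factor = solve-∀
    cancel : ∀ x p b → (+ 1 - (+ 1 + x * p)) * b ≡ - (x * b) * p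
    cancel = solve-∀

  linear-congruence : ∀ {k} → ¬ + p ∣ k → ∀ b → ∃ λ t → + p ∣ k * t + b
  linear-congruence {k} p∤k b
    with linear-congruenceᴺ (λ p∣∣k∣ → p∤k (∣ᵤ⇒∣ {+ p} {k} p∣∣k∣)) b | ℤ.+∣i∣≡i⊎+∣i∣≡-i k
  ... | t , p∣ | inj₁ ∣k∣≡k  = t , subst (λ k → + p ∣ k * t + b) ∣k∣≡k p∣
  ... | t , p∣ | inj₂ ∣k∣≡-k = - t , subst (λ x → + p ∣ x + b) ∣k∣t≡k[-t] p∣
    where
    ∣k∣t≡k[-t] : + ℤ.∣ k ∣ * t ≡ k * - t
    ∣k∣t≡k[-t] = trans (cong (_* t) ∣k∣≡-k) (trans (sym (ℤ.neg-distribˡ-* k t)) (ℤ.neg-distribʳ-* k t))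

  ∣²-cancel : ∀ {k} x → ¬ + p ∣ k → + p * + p ∣ k * x → + p * + p ∣ x
  ∣²-cancel {k} x p∤k p²∣kx = ∣ᵤ⇒∣ (ℤ.coprime-divisor (+ p * + p) k x coprime (∣⇒∣ᵤ p²∣kx))
    where
    coprime : ℤ.Coprime (+ p * + p) k
    coprime = subst (λ n → Coprime n ℤ.∣ k ∣) (sym (ℤ.abs-* (+ p) (+ p)))
                (coprime-square (∤⇒coprime (λ p∣∣k∣ → p∤k (∣ᵤ⇒∣ {+ p} {k} p∣∣k∣))))

module _ {p : ℕ} (p-prime : Prime p) (p∤2 : ¬ + p ∣ + 2) where

  completing-square : ∀ {a b c n} → + p * + p ∣ disc (a , b , c) → ¬ + p ∣ a → ¬ + p ∣ n →
                      ∃ λ t → + p * + p ∣ a * (n * t) * (n * t) + b * (n * t) + c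
  completing-square {a} {b} {c} {n} p²∣disc p∤a p∤n = t , ∣²-cancel p-prime _ p∤4a p²∣4a*value
    where
    p∤2a : ¬ + p ∣ + 2 * a
    p∤2a = ∤*∤⇒∤* p-prime p∤2 p∤a
    solution = linear-congruence p-prime (∤*∤⇒∤* p-prime p∤2a p∤n) b
    t = proj₁ solution
    p∤4a : ¬ + p ∣ + 4 * a
    p∤4a = subst (λ x → ¬ + p ∣ x) (sym (ℤ.*-assoc (+ 2) (+ 2) a)) (∤*∤⇒∤* p-prime p∤2 p∤2a)
    -- 4a·Q(nt,1) = (2ant + b)² − disc, and t was chosen so that p ∣ 2ant + b.
    p²∣4a*value : + p * + p ∣ + 4 * a * (a * (n * t) * (n * t) + b * (n * t) + c)
    p²∣4a*value = subst (+ p * + p ∣_) (sym (complete a b c (n * t)))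
                    (∣m∣n⇒∣m-n (∣⇒∣² p∣2ant+b) p²∣disc)
      where
      complete : ∀ a b c x →
        + 4 * a * (a * x * x + b * x + c) ≡ (+ 2 * a * x + b) * (+ 2 * a * x + b) - (b * b - + 4 * a * c)
      p∣2ant+b : + p ∣ + 2 * a * (n * t) + b
      p∣2ant+b = subst (+ p ∣_) (cong (_+ b) (ℤ.*-assoc (+ 2 * a) n t)) (proj₂ solution)
      complete = solve-∀

  completing-square′ : ∀ {a b c n} → + p * + p ∣ disc (a , b , c) → ¬ + p ∣ c → ¬ + p ∣ n →
                       ∃ λ t → + p * + p ∣ a + b * (n * t) + c * (n * t) * (n * t)
  completing-square′ {a} {b} {c} {n} p²∣disc p∤c p∤n =
    t , subst (+ p * + p ∣_) (value-swap a b c (n * t)) p²∣value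
    where
    disc-swap : ∀ a b c → b * b - + 4 * a * c ≡ b * b - + 4 * c * a
    disc-swap = solve-∀
    value-swap : ∀ a b c x → c * x * x + b * x + a ≡ a + b * x + c * x * x
    value-swap = solve-∀
    solution = completing-square {c} {b} {a} {n} (subst (+ p * + p ∣_) (disc-swap a b c) p²∣disc) p∤c p∤n
    t = proj₁ solution
    p²∣value = proj₂ solution

module _ (p : ℕ) .{{_ : ℕ.NonZero p}} where

  tau-* : ∀ {A a b c} → A ≡ a * + p → tau p (A , b , c) ≡ (a , b , c * + p)
  tau-* {a = a} refl = form-≡ (i*n/n≡i a p) refl refl

  det-conj : ∀ α β γ δ → α * δ - β * + p * γ ≡ α * δ - β * (γ * + p)
  det-conj α β γ δ = rearrange α β γ δ (+ p)
    where
    rearrange : ∀ α β γ δ P → α * δ - β * P * γ ≡ α * δ - β * (γ * P)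
    rearrange = solve-∀

  -- h = diag(1, p) · g · diag(1, p)⁻¹, which is how τ intertwines the two actions.
  Conjugate : ∀ {M M′} → Γ₀ M → Γ₀ M′ → Set
  Conjugate h g = Γ₀.α h ≡ Γ₀.α g × Γ₀.β g ≡ Γ₀.β h * + p × Γ₀.γ h ≡ Γ₀.γ g * + p × Γ₀.δ h ≡ Γ₀.δ g

  act-conj : ∀ {M M′ A a A′ x b c y z} (h : Γ₀ M) (g : Γ₀ M′) → Conjugate h g →
    A ≡ a * + p → A′ ≡ x * + p →
    act (A , b , c) h ≡ (A′ , y , z) ⇔ act (a , b , c * + p) g ≡ (x , y , z * + p)
  act-conj {a = a} {x = x} {b = b} {c = c} {z = z}
    (mat α β _ δ _ _) (mat _ _ γ _ _ _) (refl , refl , refl , refl) refl refl =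
    mk⇔
      (λ eq → form-≡
        (ℤ.*-cancelʳ-≡ _ x (+ p) (trans (sym (first a b c α γ (+ p))) (cong proj₁ eq)))
        (trans (sym (middle a b c α β γ δ (+ p))) (cong (proj₁ ∘ proj₂) eq))
        (trans (last a b c β δ (+ p)) (cong (_* + p) (cong (proj₂ ∘ proj₂) eq))))
      (λ eq → form-≡
        (trans (first a b c α γ (+ p)) (cong (_* + p) (cong proj₁ eq)))
        (trans (middle a b c α β γ δ (+ p)) (cong (proj₁ ∘ proj₂) eq))
        (ℤ.*-cancelʳ-≡ _ z (+ p) (trans (sym (last a b c β δ (+ p))) (cong (proj₂ ∘ proj₂) eq))))
    where
    first : ∀ a b c α γ P → (a * P) * α * α + b * α * (γ * P) + c * (γ * P) * (γ * P)
                          ≡ (a * α * α + b * α * γ + c * P * γ * γ) * P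
    first = solve-∀
    middle : ∀ a b c α β γ δ P →
      + 2 * (a * P) * α * β + b * (α * δ + β * (γ * P)) + + 2 * c * (γ * P) * δ
        ≡ + 2 * a * α * (β * P) + b * (α * δ + (β * P) * γ) + + 2 * (c * P) * γ * δ
    middle = solve-∀
    last : ∀ a b c β δ P → a * (β * P) * (β * P) + b * (β * P) * δ + (c * P) * δ * δ
                         ≡ ((a * P) * β * β + b * β * δ + c * δ * δ) * P
    last = solve-∀

odd-prime∤2 : ∀ {p} → Prime p → p ℕ.% 2 ≡ 1 → ¬ + p ∣ + 2
odd-prime∤2 p-prime odd p∣2 with prime⇒irreducible prime[2] (∣⇒∣ᵤ p∣2)
... | inj₁ refl = ¬prime[1] p-prime
... | inj₂ refl = contradiction odd λ ()

module LevelRaising {p N N₀ : ℕ} {D : ℤ} .{{_ : ℕ.NonZero p}} (p-prime : Prime p) (p∤2 : ¬ + p ∣ + 2)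
  (p∤N : ¬ p ℕ.∣ N) (N₀∣N : N₀ ℕ.∣ N) (p²∣D : + p * + p ∣ D) where

  𝓛 𝓛ᵖ 𝓛ᵖᵃ 𝓛ᵖᶜ : Form → Set
  𝓛   = InL N₀ N D
  𝓛ᵖ  = InLp p N₀ N D
  𝓛ᵖᵃ = InLpa p N₀ (N ℕ.* p) D
  𝓛ᵖᶜ = InLpc p N₀ (N ℕ.* p) D

  p∤N′ : ¬ + p ∣ + N
  p∤N′ p∣N = p∤N (∣⇒∣ᵤ p∣N)

  N⊥p : Coprime N p
  N⊥p = Coprimality.sym (∤⇒coprime p-prime p∤N)

  p²∣disc : ∀ Q → disc Q ≡ D → + p * + p ∣ disc Q
  p²∣disc _ disc≡D = subst (+ p * + p ∣_) (sym disc≡D) p²∣D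

  p∣b : ∀ {A b c} → disc (A , b , c) ≡ D → + p ∣ A ⊎ + p ∣ c → + p ∣ b
  p∣b {A} {b} {c} disc≡D p∣A⊎p∣c = ∣x*x⇒∣x p-prime b (subst (+ p ∣_) (b*b≡disc+4Ac b (+ 4 * A * c))
    (∣m∣n⇒∣m+n (∣-trans (∣n⇒∣m*n (+ p) ∣-refl) (p²∣disc (A , b , c) disc≡D)) (p∣4Ac p∣A⊎p∣c)))
    where
    b*b≡disc+4Ac : ∀ b x → b * b - x + x ≡ b * b
    b*b≡disc+4Ac = solve-∀
    p∣4Ac : + p ∣ A ⊎ + p ∣ c → + p ∣ + 4 * A * c
    p∣4Ac (inj₁ p∣A) = ∣m⇒∣m*n c (∣n⇒∣m*n (+ 4) p∣A)
    p∣4Ac (inj₂ p∣c) = ∣n⇒∣m*n (+ 4 * A) p∣c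

  𝓛-upper : ∀ {a b c} t → + N ∣ t → 𝓛 (a , b , c) → 𝓛 (a , b + + 2 * a * t , a * t * t + b * t + c)
  𝓛-upper {a} {b} {c} t N∣t (disc≡D , N∣a , N₀⊥c) =
    trans (cong disc (sym (act-upper {N} a b c t))) (trans (disc-act (a , b , c) (upper {N} t)) disc≡D) ,
    N∣a ,
    coprime-+∣ (∣m∣n⇒∣m+n (∣n⇒∣m*n (a * t) N₀∣t) (∣n⇒∣m*n b N₀∣t)) N₀⊥c
    where
    N₀∣t : + N₀ ∣ t
    N₀∣t = ∣-trans (∣ᵤ⇒∣ {+ N₀} {+ N} N₀∣N) N∣t

  𝓛-lower : ∀ {a b c} s (N∣s : + N ∣ s) → 𝓛 (a , b , c) → 𝓛 (a + b * s + c * s * s , b + + 2 * c * s , c)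
  𝓛-lower {a} {b} {c} s N∣s (disc≡D , N∣a , N₀⊥c) =
    trans (cong disc (sym (act-lower a b c s N∣s))) (trans (disc-act (a , b , c) (lower s N∣s)) disc≡D) ,
    ∣⇒∣ᵤ (∣m∣n⇒∣m+n (∣m∣n⇒∣m+n (∣ᵤ⇒∣ {+ N} {a} N∣a) (∣n⇒∣m*n b N∣s)) (∣m⇒∣m*n s (∣n⇒∣m*n c N∣s))) ,
    N₀⊥c

  𝓛ᵖᵃ-intro : ∀ {A b c} → disc (A , b , c) ≡ D → N ℕ.* (p ℕ.* p) ℕ.∣ ℤ.∣ A ∣ →
              Coprime N₀ ℤ.∣ c ∣ → ¬ + p ∣ c → 𝓛ᵖᵃ (A , b , c)
  𝓛ᵖᵃ-intro {A} {b} {c} disc≡D Np²∣A N₀⊥c p∤c =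
    ((disc≡D , ∣⇒∣ᵤ (divides a A≡a*Np) , N₀⊥c) , (a , A≡a*Np , λ (_ , _ , p∣c) → p∤cᵤ p∣c)) ,
    (a , A≡a*Np , ∣⇒∣ᵤ (divides j refl) , p∤cᵤ)
    where
    j = quotient (∣ᵤ⇒∣ {+ (N ℕ.* (p ℕ.* p))} {A} Np²∣A)
    a = j * + p
    p∤cᵤ = ∤⇒∤ᵤ c p∤c
    A≡a*Np : A ≡ a * + (N ℕ.* p)
    A≡a*Np = begin
      A                              ≡⟨ _∣_.equality (∣ᵤ⇒∣ {+ (N ℕ.* (p ℕ.* p))} {A} Np²∣A) ⟩
      j * + (N ℕ.* (p ℕ.* p))        ≡⟨ cong (j *_) (trans (ℤ.pos-* N _) (cong (+ N *_) (ℤ.pos-* p p))) ⟩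
      j * (+ N * (+ p * + p))        ≡⟨ regroup j (+ N) (+ p) ⟩
      j * + p * (+ N * + p)          ≡⟨ cong (a *_) (ℤ.pos-* N p) ⟨
      a * + (N ℕ.* p)                ∎
      where
      regroup : ∀ j n p → j * (n * (p * p)) ≡ j * p * (n * p)
      regroup = solve-∀

  𝓛ᵖᵃ⇒𝓛ᵖ : ∀ {Q} → 𝓛ᵖᵃ Q → 𝓛ᵖ Q
  𝓛ᵖᵃ⇒𝓛ᵖ {A , b , c} (((disc≡D , _ , N₀⊥c) , _) , (a , A≡a*Np , _ , p∤c)) =
    (disc≡D , ∣⇒∣ᵤ (divides (a * + p) A≡ap*N) , N₀⊥c) , (a * + p , A≡ap*N , λ (_ , _ , p∣c) → p∤c p∣c)
    where
    A≡ap*N : A ≡ a * + p * + N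
    A≡ap*N = trans A≡a*Np (trans (cong (λ n → a * + n) (ℕ.*-comm N p)) (*-pos-* a p N))

  𝓛ᵖᵃ-reflects : ∀ {Q Q′} → 𝓛ᵖᵃ Q → 𝓛ᵖᵃ Q′ → Equiv N Q Q′ → Equiv (N ℕ.* p) Q Q′
  𝓛ᵖᵃ-reflects {A , b , c} (((disc≡D , Np∣A , _) , _) , (_ , _ , _ , p∤c)) (((_ , Np∣A′ , _) , _) , _)
    (mat α β γ δ e N∣γ , refl) =
    mat α β γ δ e (coprime⇒*∣ N⊥p N∣γ (∣⇒∣ᵤ p∣γ)) , refl
    where
    Np∣⇒p∣ : ∀ x → + (N ℕ.* p) ∣ᵤ x → + p ∣ x
    Np∣⇒p∣ x Np∣x = ∣ᵤ⇒∣ {+ p} {x} (ℕ.∣-trans (ℕ.n∣m*n N) Np∣x)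
    p∣A = Np∣⇒p∣ A Np∣A
    p∣cγγ : + p ∣ c * γ * γ
    p∣cγγ = ∣m+n∣m⇒∣n (Np∣⇒p∣ _ Np∣A′)
      (∣m∣n⇒∣m+n (∣m⇒∣m*n α (∣m⇒∣m*n α p∣A)) (∣m⇒∣m*n γ (∣m⇒∣m*n α (p∣b {A} {b} {c} disc≡D (inj₁ p∣A)))))
    p∣γ : + p ∣ γ
    p∣γ = ∣k*x*x⇒∣x p-prime {c} γ (λ p∣c → p∤c (∣⇒∣ᵤ p∣c)) p∣cγγ

  upper-shift : ∀ {R} → 𝓛ᵖ R → ∃ λ R₁ → 𝓛 R₁ × ¬ + p ∣ coeffC R₁ × Equiv N R R₁
  upper-shift {A , b , c} (R∈𝓛@(disc≡D , _ , _) , (a , A≡aN , p∤gcd)) with + p ∣? c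
  ... | no p∤c  = (A , b , c) , R∈𝓛 , p∤c , Equiv-refl
  ... | yes p∣c =
    _ , 𝓛-upper {A} {b} {c} (+ N) ∣-refl R∈𝓛 , ∤-quadratic p-prime {A} {b} {c} {+ N} p∤A p∤N′ p∣b′ p∣c ,
    upper {N} (+ N) , act-upper {N} A b c (+ N)
    where
    p∣b′ : + p ∣ b
    p∣b′ = p∣b {A} {b} {c} disc≡D (inj₂ p∣c)
    p∤a : ¬ + p ∣ a
    p∤a p∣a = p∤gcd (∣⇒∣ᵤ p∣a , ∣⇒∣ᵤ p∣b′ , ∣⇒∣ᵤ p∣c)
    p∤A : ¬ + p ∣ A
    p∤A p∣A = ∤*∤⇒∤* p-prime {a} {+ N} p∤a p∤N′ (subst (+ p ∣_) A≡aN p∣A)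

  lower-complete : ∀ {R} → 𝓛 R → ¬ + p ∣ coeffC R → ∃ λ Q → 𝓛ᵖᵃ Q × Equiv N R Q
  lower-complete {a , b , c} R∈𝓛@(disc≡D , _ , _) p∤c =
    _ , 𝓛ᵖᵃ-intro {a + b * s + c * s * s} {b + + 2 * c * s} {c}
          disc≡D′ (coprime⇒*∣ N⊥p² N∣A₂ p²∣A₂) N₀⊥c p∤c ,
    lower s N∣s , act-lower a b c s N∣s
    where
    solution = completing-square′ p-prime p∤2 {a} {b} {c} {+ N} (p²∣disc (a , b , c) disc≡D) p∤c p∤N′
    s = + N * proj₁ solution
    N∣s : + N ∣ s
    N∣s = ∣m⇒∣m*n (proj₁ solution) ∣-refl
    R₂∈𝓛 = 𝓛-lower {a} {b} {c} s N∣s R∈𝓛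
    disc≡D′ = proj₁ R₂∈𝓛
    N∣A₂ = proj₁ (proj₂ R₂∈𝓛)
    N₀⊥c = proj₂ (proj₂ R₂∈𝓛)
    p²∣A₂ : p ℕ.* p ℕ.∣ ℤ.∣ a + b * s + c * s * s ∣
    p²∣A₂ = subst (ℕ._∣ ℤ.∣ a + b * s + c * s * s ∣) (ℤ.abs-* (+ p) (+ p)) (∣⇒∣ᵤ (proj₂ solution))
    N⊥p² : Coprime N (p ℕ.* p)
    N⊥p² = Coprimality.sym (coprime-square (Coprimality.sym N⊥p))

  𝓛ᵖᵃ-surjective : ∀ R → 𝓛ᵖ R → ∃ λ Q → 𝓛ᵖᵃ Q × Equiv N (idMap Q) R
  𝓛ᵖᵃ-surjective R R∈𝓛ᵖ =
    let R₁ , R₁∈𝓛 , p∤c₁ , R~R₁ = upper-shift {R} R∈𝓛ᵖ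
        Q , Q∈𝓛ᵖᵃ , R₁~Q = lower-complete {R₁} R₁∈𝓛 p∤c₁
    in Q , Q∈𝓛ᵖᵃ , Equiv-sym {N} {R} {Q} (Equiv-trans {N} {R} {R₁} {Q} R~R₁ R₁~Q)

  id-bijection : InducesBijection 𝓛ᵖᵃ (N ℕ.* p) 𝓛ᵖ N idMap
  id-bijection =
    (λ Q → 𝓛ᵖᵃ⇒𝓛ᵖ {Q}) ,
    (λ Q Q′ _ _ → Equiv-∣ {N} {N ℕ.* p} {Q} {Q′} (ℕ.m∣m*n p)) ,
    (λ Q Q′ → 𝓛ᵖᵃ-reflects {Q} {Q′}) ,
    𝓛ᵖᵃ-surjective

  p∤N₀ : ¬ p ℕ.∣ N₀
  p∤N₀ p∣N₀ = p∤N (ℕ.∣-trans p∣N₀ N₀∣N)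

  𝓛ᵖᶜ-intro : ∀ {a b c} → disc (a * + p , b , c) ≡ D → + N ∣ a → Coprime N₀ ℤ.∣ c ∣ →
              ¬ + p ∣ a → + p ∣ c → 𝓛ᵖᶜ (a * + p , b , c)
  𝓛ᵖᶜ-intro {b = b} {c} disc≡D (divides a′ refl) N₀⊥c p∤a p∣c =
    ((disc≡D , ∣⇒∣ᵤ (divides a′ A≡) , N₀⊥c) , (a′ , A≡ , λ (p∣a′ , _ , _) → p∤a′ p∣a′)) ,
    (a′ , A≡ , p∤a′ , ∣⇒∣ᵤ p∣c)
    where
    A≡ : a′ * + N * + p ≡ a′ * + (N ℕ.* p)
    A≡ = sym (*-pos-* a′ N p)
    p∤a′ : ¬ + p ∣ᵤ a′
    p∤a′ = ∤⇒∤ᵤ a′ (λ p∣a′ → p∤a (∣m⇒∣m*n (+ N) p∣a′))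

  tau-𝓛ᵖᶜ⇒𝓛ᵖ : ∀ {Q} → 𝓛ᵖᶜ Q → 𝓛ᵖ (tau p Q)
  tau-𝓛ᵖᶜ⇒𝓛ᵖ {A , b , c} (((disc≡D , _ , N₀⊥c) , _) , (a , A≡aNp , p∤a , _)) =
    subst 𝓛ᵖ (sym (tau-* p {A} {a * + N} {b} {c} A≡aN*p))
      ((disc≡D′ , ∣⇒∣ᵤ (divides a refl) , N₀⊥cp) , (a , refl , λ (p∣a , _ , _) → p∤a p∣a))
    where
    A≡aN*p : A ≡ a * + N * + p
    A≡aN*p = trans A≡aNp (*-pos-* a N p)
    disc≡D′ : disc (a * + N , b , c * + p) ≡ D
    disc≡D′ = trans (regroup b (a * + N) c (+ p))
                (trans (cong (λ A → b * b - + 4 * A * c) (sym A≡aN*p)) disc≡D)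
      where
      regroup : ∀ b x c P → b * b - + 4 * x * (c * P) ≡ b * b - + 4 * (x * P) * c
      regroup = solve-∀
    N₀⊥cp : Coprime N₀ ℤ.∣ c * + p ∣
    N₀⊥cp = subst (Coprime N₀) (sym (ℤ.abs-* c (+ p)))
              (coprime-* N₀⊥c (Coprimality.sym (∤⇒coprime p-prime p∤N₀)))

  𝓛ᵖᶜ-respects : ∀ {Q Q′} → 𝓛ᵖᶜ Q → 𝓛ᵖᶜ Q′ → Equiv (N ℕ.* p) Q Q′ → Equiv N (tau p Q) (tau p Q′)
  𝓛ᵖᶜ-respects {A , b , c} {A′ , b′ , c′} (_ , (a , A≡ , _)) (_ , (a′ , A′≡ , _))
    (h@(mat α β γ δ e Np∣γ) , act≡) =
    g , subst₂ (λ R R′ → act R g ≡ R′)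
          (sym (tau-* p {A} {a * + N} {b} {c} A≡₁)) (sym (tau-* p {A′} {a′ * + N} {b′} {c′} A′≡₁))
          (Equivalence.to (act-conj p {A = A} {a * + N} {A′} {a′ * + N} {b} {c} h g
                                    (refl , refl , γ≡ , refl) A≡₁ A′≡₁) act≡)
    where
    A≡₁ = trans A≡ (*-pos-* a N p)
    A′≡₁ = trans A′≡ (*-pos-* a′ N p)
    Np∣γ′ = ∣ᵤ⇒∣ {+ (N ℕ.* p)} {γ} Np∣γ
    k = quotient Np∣γ′
    γ≡ : γ ≡ k * + N * + p
    γ≡ = trans (_∣_.equality Np∣γ′) (*-pos-* k N p)
    g : Γ₀ N
    g = mat α (β * + p) (k * + N) δ
          (trans (det-conj p α β (k * + N) δ) (trans (cong (λ γ → α * δ - β * γ) (sym γ≡)) e))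
          (∣⇒∣ᵤ (divides k refl))

  𝓛ᵖᶜ-reflects : ∀ {Q Q′} → 𝓛ᵖᶜ Q → 𝓛ᵖᶜ Q′ → Equiv N (tau p Q) (tau p Q′) → Equiv (N ℕ.* p) Q Q′
  𝓛ᵖᶜ-reflects {A , b , c} {A′ , b′ , c′} (((disc≡D , _ , _) , _) , (a , A≡ , p∤a , p∣c))
    (_ , (a′ , A′≡ , _))
    (g@(mat α β γ δ e N∣γ) , act≡) =
    h , Equivalence.from (act-conj p {A = A} {a * + N} {A′} {a′ * + N} {b} {c} h g
                                   (refl , β≡ , refl , refl) A≡₁ A′≡₁) act≡′
    where
    A≡₁ = trans A≡ (*-pos-* a N p)
    A′≡₁ = trans A′≡ (*-pos-* a′ N p)
    act≡′ : act (a * + N , b , c * + p) g ≡ (a′ * + N , b′ , c′ * + p)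
    act≡′ = subst₂ (λ R R′ → act R g ≡ R′)
              (tau-* p {A} {a * + N} {b} {c} A≡₁) (tau-* p {A′} {a′ * + N} {b′} {c′} A′≡₁) act≡
    p∣*p : ∀ x → + p ∣ x * + p
    p∣*p x = divides x refl
    p∣b′ : + p ∣ b
    p∣b′ = p∣b {A} {b} {c} disc≡D (inj₂ (∣ᵤ⇒∣ {+ p} {c} p∣c))
    p∣aNββ : + p ∣ a * + N * β * β
    p∣aNββ = ∣m+n∣n⇒∣m (∣m+n∣n⇒∣m (subst (+ p ∣_) (sym (cong (proj₂ ∘ proj₂) act≡′)) (p∣*p c′))
                                  (∣m⇒∣m*n δ (∣m⇒∣m*n δ (p∣*p c))))
                       (∣m⇒∣m*n δ (∣m⇒∣m*n β p∣b′))
    p∣β : + p ∣ β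
    p∤aN : ¬ + p ∣ a * + N
    p∤aN = ∤*∤⇒∤* p-prime {a} {+ N} (λ p∣a → p∤a (∣⇒∣ᵤ p∣a)) p∤N′
    p∣β = ∣k*x*x⇒∣x p-prime {a * + N} β p∤aN p∣aNββ
    l = quotient p∣β
    β≡ : β ≡ l * + p
    β≡ = _∣_.equality p∣β
    h : Γ₀ (N ℕ.* p)
    h = mat α l (γ * + p) δ
          (trans (sym (det-conj p α l γ δ)) (trans (cong (λ β → α * δ - β * γ) (sym β≡)) e))
          (subst (N ℕ.* p ℕ.∣_) (sym (ℤ.abs-* γ (+ p))) (ℕ.*-monoˡ-∣ p N∣γ))

  lower-shift : ∀ {R} → 𝓛ᵖ R → ∃ λ R₁ → 𝓛 R₁ × ¬ + p ∣ coeffA R₁ × Equiv N R R₁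
  lower-shift {A , b , c} (R∈𝓛@(disc≡D , _ , _) , (a , A≡aN , p∤gcd)) with + p ∣? A
  ... | no p∤A  = (A , b , c) , R∈𝓛 , p∤A , Equiv-refl
  ... | yes p∣A =
    _ , 𝓛-lower {A} {b} {c} (+ N) ∣-refl R∈𝓛 , p∤A₁ , lower (+ N) ∣-refl , act-lower A b c (+ N) ∣-refl
    where
    p∣b′ : + p ∣ b
    p∣b′ = p∣b {A} {b} {c} disc≡D (inj₁ p∣A)
    p∣a : + p ∣ a
    p∣a with ∣*⇒∣⊎∣ p-prime a (+ N) (subst (+ p ∣_) A≡aN p∣A)
    ... | inj₁ p∣a = p∣a
    ... | inj₂ p∣N = contradiction p∣N p∤N′
    p∤c : ¬ + p ∣ c
    p∤c p∣c = p∤gcd (∣⇒∣ᵤ p∣a , ∣⇒∣ᵤ p∣b′ , ∣⇒∣ᵤ p∣c)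
    p∤A₁ : ¬ + p ∣ A + b * + N + c * + N * + N
    p∤A₁ = subst (λ x → ¬ + p ∣ x) (reverse A b c (+ N))
             (∤-quadratic p-prime {c} {b} {A} {+ N} p∤c p∤N′ p∣b′ p∣A)
      where
      reverse : ∀ A b c n → c * n * n + b * n + A ≡ A + b * n + c * n * n
      reverse = solve-∀

  upper-complete : ∀ {R} → 𝓛 R → ¬ + p ∣ coeffA R → ∃ λ Q → 𝓛ᵖᶜ Q × Equiv N R (tau p Q)
  upper-complete {a , b , c} R∈𝓛@(disc≡D , N∣a , _) p∤a =
    (a * + p , b₂ , m * + p) ,
    𝓛ᵖᶜ-intro {a} {b₂} {m * + p} disc≡D′ (∣ᵤ⇒∣ {+ N} {a} N∣a) N₀⊥mp p∤a (∣n⇒∣m*n m ∣-refl) ,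
    upper {N} s , trans (act-upper {N} a b c s) (sym τQ≡R₂)
    where
    solution = completing-square p-prime p∤2 {a} {b} {c} {+ N} (p²∣disc (a , b , c) disc≡D) p∤a p∤N′
    s = + N * proj₁ solution
    N∣s : + N ∣ s
    N∣s = ∣m⇒∣m*n (proj₁ solution) ∣-refl
    b₂ = b + + 2 * a * s
    c₂ = a * s * s + b * s + c
    R₂∈𝓛 = 𝓛-upper {a} {b} {c} s N∣s R∈𝓛
    m = quotient (proj₂ solution)
    c₂≡ : c₂ ≡ m * (+ p * + p)
    c₂≡ = _∣_.equality (proj₂ solution)
    τQ≡R₂ : tau p (a * + p , b₂ , m * + p) ≡ (a , b₂ , c₂)
    τQ≡R₂ = trans (tau-* p {a * + p} {a} {b₂} {m * + p} refl)
                  (form-≡ refl refl (trans (ℤ.*-assoc m (+ p) (+ p)) (sym c₂≡)))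
    disc≡D′ : disc (a * + p , b₂ , m * + p) ≡ D
    disc≡D′ = trans (regroup b₂ a m (+ p))
                (trans (cong (λ z → b₂ * b₂ - + 4 * a * z) (sym c₂≡)) (proj₁ R₂∈𝓛))
      where
      regroup : ∀ b a m P → b * b - + 4 * (a * P) * (m * P) ≡ b * b - + 4 * a * (m * (P * P))
      regroup = solve-∀
    N₀⊥mp : Coprime N₀ ℤ.∣ m * + p ∣
    N₀⊥mp = coprime-∣ (proj₂ (proj₂ R₂∈𝓛)) (∣⇒∣ᵤ (divides (+ p) (trans c₂≡ (regroup m (+ p)))))
      where
      regroup : ∀ m P → m * (P * P) ≡ P * (m * P)
      regroup = solve-∀

  𝓛ᵖᶜ-surjective : ∀ R → 𝓛ᵖ R → ∃ λ Q → 𝓛ᵖᶜ Q × Equiv N (tau p Q) R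
  𝓛ᵖᶜ-surjective R R∈𝓛ᵖ =
    let R₁ , R₁∈𝓛 , p∤a₁ , R~R₁ = lower-shift {R} R∈𝓛ᵖ
        Q , Q∈𝓛ᵖᶜ , R₁~τQ = upper-complete {R₁} R₁∈𝓛 p∤a₁
    in Q , Q∈𝓛ᵖᶜ , Equiv-sym {N} {R} {tau p Q} (Equiv-trans {N} {R} {R₁} {tau p Q} R~R₁ R₁~τQ)

  tau-bijection : InducesBijection 𝓛ᵖᶜ (N ℕ.* p) 𝓛ᵖ N (tau p)
  tau-bijection =
    (λ Q → tau-𝓛ᵖᶜ⇒𝓛ᵖ {Q}) ,
    (λ Q Q′ → 𝓛ᵖᶜ-respects {Q} {Q′}) ,
    (λ Q Q′ → 𝓛ᵖᶜ-reflects {Q} {Q′}) ,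
    𝓛ᵖᶜ-surjective

corollary3p5 : (N N₀ N₁ p : ℕ) (Δ : ℤ) → .{{_ : ℕ.NonZero p}} →
    N ℕ.≥ 1 → N ℕ.% 2 ≡ 1 → N ≡ N₀ ℕ.* N₁ → N₀ ℕ.≥ 1 → N₁ ℕ.≥ 1 → Coprime N₀ N₁ →
    Prime p → p ℕ.% 2 ≡ 1 → ¬ (p ℕ.∣ N) →
    (Δ ℤ.% + 4 ≡ 0 ⊎ Δ ℤ.% + 4 ≡ 1) → + (p ℕ.^ 2) ∣ᵤ Δ →
    InducesBijection (InLpa p N₀ (N ℕ.* p) (+ (N₀ ℕ.^ 2) * Δ)) (N ℕ.* p)
                     (InLp p N₀ N (+ (N₀ ℕ.^ 2) * Δ)) N idMap
    × InducesBijection (InLpc p N₀ (N ℕ.* p) (+ (N₀ ℕ.^ 2) * Δ)) (N ℕ.* p)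
                       (InLp p N₀ N (+ (N₀ ℕ.^ 2) * Δ)) N (tau p)
corollary3p5 N N₀ N₁ p Δ _ _ N≡N₀N₁ _ _ _ p-prime p-odd p∤N _ p²∣Δ = id-bijection , tau-bijection
  where
  N₀∣N : N₀ ℕ.∣ N
  N₀∣N = ℕ.divides N₁ (trans N≡N₀N₁ (ℕ.*-comm N₀ N₁))
  p²∣D : + p * + p ∣ + (N₀ ℕ.^ 2) * Δ
  p²∣D = ∣n⇒∣m*n (+ (N₀ ℕ.^ 2)) (subst (_∣ Δ) p^2≡p*p (∣ᵤ⇒∣ {+ (p ℕ.^ 2)} {Δ} p²∣Δ))
    where
    p^2≡p*p : + (p ℕ.^ 2) ≡ + p * + p
    p^2≡p*p = trans (cong (λ n → + (p ℕ.* n)) (ℕ.*-identityʳ p)) (ℤ.pos-* p p)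
  open LevelRaising p-prime (odd-prime∤2 p-prime p-odd) p∤N N₀∣N p²∣D
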